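{- For every natural number $n\ge2$, the problem $\text{2CC}_n$ belongs to $\Sigma_2^p$.
   Context: $\text{2CC}$ is the set of finite simple graphs (structures over $\langle E^2\rangle$ with universe $\{0,\dots,m-1\}$, $E$ symmetric and irreflexive) admitting a 2-coloring of the vertices such that no maximal clique is monochromatic. $\text{2CC}_n:=\text{2CC}\cup\{\mathcal A\in\mathrm{STRUC}[E^2]:\|\mathcal A\|<n\}$, where $\|\mathcal A\|$ is the size of the universe. $\Sigma_2^p$ is the class of problems MOD$[\Phi]$ (sets of finite models, with numeric symbols $\le$, BIT, PLUS, TIMES, SUC, $0,1,\max$ given standard interpretations) where $\Phi$ is a second-order sentence of the form $\exists\vec R_1\forall\vec R_2\,\varphi$ with $\varphi$ first order. -}

module Defs where

open import Data.Nat using (ℕ; zero; suc; _+_; _*_; _<_; _≤_)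
open import Data.Nat.DivMod using (_/_; _%_)
open import Data.Fin using (Fin; toℕ) renaming (zero to fzero; suc to fsuc)
open import Data.Fin using () renaming (fromℕ to fromℕF)
open import Data.Bool using (Bool; true; false; T)
open import Data.Vec using (Vec; []; _∷_)
import Data.Vec as Vec
open import Data.List using (List; _++_)
open import Data.List.Membership.Propositional using (_∈_)
open import Data.List.Relation.Unary.All using (All)
import Data.List.Relation.Unary.All as All
open import Data.List.Relation.Unary.All.Properties using (++⁺)
open import Data.Product using (Σ; _×_; _,_; ∃)
open import Data.Sum using (_⊎_)
open import Data.Empty using (⊥)
open import Relation.Nullary using (¬_)
open import Relation.Binary.PropositionalEquality using (_≡_; _≢_)
open import Function.Bundles using (_⇔_)

-- Finite structures over the vocabulary ⟨E²⟩.
-- The universe is {0,…,m-1} with m = suc k ≥ 1 (nonempty universe,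
-- the standard convention of descriptive complexity).

record Structure : Set where
  constructor mkStructure
  field
    k : ℕ
    E : Fin (suc k) → Fin (suc k) → Bool

open Structure public

size : Structure → ℕ
size A = suc (k A)

IsSimpleGraph : Structure → Set
IsSimpleGraph A =
  (∀ x y → E A x y ≡ E A y x) × (∀ x → E A x x ≡ false)

VSubset : Structure → Set
VSubset A = Fin (size A) → Bool

IsClique : (A : Structure) → VSubset A → Set
IsClique A S = ∀ x y → T (S x) → T (S y) → x ≢ y → T (E A x y)

IsMaximalClique : (A : Structure) → VSubset A → Set
IsMaximalClique A S =
  IsClique A S ×
  (∀ S′ → IsClique A S′ → (∀ x → T (S x) → T (S′ x)) →
          ∀ x → T (S′ x) → T (S x))

Monochromatic : (A : Structure) → (Fin (size A) → Bool) → VSubset A → Set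
Monochromatic A c S = Σ Bool λ b → ∀ x → T (S x) → c x ≡ b

In2CC : Structure → Set
In2CC A =
  IsSimpleGraph A ×
  Σ (Fin (size A) → Bool) λ c →
    ∀ S → IsMaximalClique A S → ¬ Monochromatic A c S

In2CCn : ℕ → Structure → Set
In2CCn n A = In2CC A ⊎ size A < n

-- Second-order logic over ⟨E²⟩ with numeric symbols
-- ≤, BIT, PLUS, TIMES, SUC, 0, 1, max.
-- Γ : arities of the second-order (relation) variables in scope,
-- v : number of first-order variables in scope (de Bruijn).

data Term (v : ℕ) : Set where
  var  : Fin v → Term v
  c0   : Term v
  c1   : Term v
  cmax : Term v

data Formula (Γ : List ℕ) : ℕ → Set where
  edge  : ∀ {v} → Term v → Term v → Formula Γ v
  eq    : ∀ {v} → Term v → Term v → Formula Γ v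
  leq   : ∀ {v} → Term v → Term v → Formula Γ v
  bit   : ∀ {v} → Term v → Term v → Formula Γ v
  succ  : ∀ {v} → Term v → Term v → Formula Γ v
  plus  : ∀ {v} → Term v → Term v → Term v → Formula Γ v
  times : ∀ {v} → Term v → Term v → Term v → Formula Γ v
  rel   : ∀ {v a} → a ∈ Γ → Vec (Term v) a → Formula Γ v
  ¬′_   : ∀ {v} → Formula Γ v → Formula Γ v
  _∧′_  : ∀ {v} → Formula Γ v → Formula Γ v → Formula Γ v
  _∨′_  : ∀ {v} → Formula Γ v → Formula Γ v → Formula Γ v
  ∀′    : ∀ {v} → Formula Γ (suc v) → Formula Γ v
  ∃′    : ∀ {v} → Formula Γ (suc v) → Formula Γ v

testBit : ℕ → ℕ → Set
testBit i zero    = i % 2 ≡ 1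
testBit i (suc j) = testBit (i / 2) j

-- the constant 1 (interpreted as 0 when the universe is {0})
one : ∀ {k} → Fin (suc k)
one {zero}  = fzero
one {suc k} = fsuc fzero

Rel : ℕ → ℕ → Set
Rel m a = Vec (Fin m) a → Bool

evalT : ∀ {m v} → Vec (Fin (suc m)) v → Term v → Fin (suc m)
evalT ρ (var i) = Vec.lookup ρ i
evalT ρ c0      = fzero
evalT ρ c1      = one
evalT {m} ρ cmax = fromℕF m

Sat : (A : Structure) → ∀ {Γ v} →
      All (Rel (size A)) Γ → Vec (Fin (size A)) v → Formula Γ v → Set
Sat A σ ρ (edge s t)    = T (E A (evalT ρ s) (evalT ρ t))
Sat A σ ρ (eq s t)      = evalT ρ s ≡ evalT ρ t
Sat A σ ρ (leq s t)     = toℕ (evalT ρ s) ≤ toℕ (evalT ρ t)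
Sat A σ ρ (bit s t)     = testBit (toℕ (evalT ρ s)) (toℕ (evalT ρ t))
Sat A σ ρ (succ s t)    = toℕ (evalT ρ t) ≡ suc (toℕ (evalT ρ s))
Sat A σ ρ (plus s t u)  = toℕ (evalT ρ s) + toℕ (evalT ρ t) ≡ toℕ (evalT ρ u)
Sat A σ ρ (times s t u) = toℕ (evalT ρ s) * toℕ (evalT ρ t) ≡ toℕ (evalT ρ u)
Sat A σ ρ (rel x ts)    = T (All.lookup σ x (Vec.map (evalT ρ) ts))
Sat A σ ρ (¬′ φ)        = ¬ Sat A σ ρ φ
Sat A σ ρ (φ ∧′ ψ)      = Sat A σ ρ φ × Sat A σ ρ ψ
Sat A σ ρ (φ ∨′ ψ)      = Sat A σ ρ φ ⊎ Sat A σ ρ ψ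
Sat A σ ρ (∀′ φ)        = ∀ x → Sat A σ (x ∷ ρ) φ
Sat A σ ρ (∃′ φ)        = Σ (Fin (size A)) λ x → Sat A σ (x ∷ ρ) φ

-- Σ₂ second-order sentences  ∃R⃗₁ ∀R⃗₂ φ  with φ first-order
record Σ₂Sentence : Set where
  constructor mkΣ₂
  field
    Γ₁   : List ℕ
    Γ₂   : List ℕ
    body : Formula (Γ₁ ++ Γ₂) 0

Models : Structure → Σ₂Sentence → Set
Models A (mkΣ₂ Γ₁ Γ₂ φ) =
  Σ (All (Rel (size A)) Γ₁) λ σ₁ →
    (σ₂ : All (Rel (size A)) Γ₂) → Sat A (++⁺ σ₁ σ₂) [] φ

-- a problem (set of finite ⟨E²⟩-structures) is in Σ₂ᵖ iff it is MOD[Φ]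
-- for some Σ₂ second-order sentence Φ
InΣ₂p : (Structure → Set) → Set
InΣ₂p P = Σ Σ₂Sentence λ Φ → ∀ A → Models A Φ ⇔ P A

-- Quantify existentially over a colouring C and universally over a vertex set S, both
-- unary relations, and require: ‖A‖ < n, or E is symmetric and irreflexive and S is not a
-- maximal clique on which C is constant. Everything under the quantifiers is first order:
-- a clique S is maximal iff every vertex adjacent to all of S lies in S, and ‖A‖ < n iff
-- max can be counted down to 0 along SUC in fewer than n − 1 steps.
module Submission where

open import Defs
open import Data.Nat using (ℕ; zero; suc; _≤_; _<_; z≤n; s≤s)
open import Data.Nat.DivMod using (_/_; _%_)
import Data.Nat.Properties as ℕ
open import Data.Fin using (Fin; toℕ; fromℕ; inject₁) renaming (zero to fzero; suc to fsuc)
open import Data.Fin.Properties using (toℕ-fromℕ; toℕ-inject₁; all?; any?) renaming (_≟_ to _≟ᶠ_)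
open import Data.Bool using (Bool; true; false; T; _∨_)
open import Data.Bool.Properties using (T-≡)
open import Data.Vec using (Vec; []; _∷_)
open import Data.List using (List; []; _∷_)
open import Data.List.Membership.Propositional using (_∈_)
open import Data.List.Relation.Unary.Any using (here; there)
open import Data.List.Relation.Unary.All using (All; []; _∷_)
import Data.List.Relation.Unary.All as All
open import Data.Product using (_×_; _,_; proj₁; proj₂)
open import Data.Product.Function.NonDependent.Propositional using (_×-⇔_)
open import Data.Sum using (_⊎_; inj₁; inj₂; [_,_])
open import Data.Sum.Function.Propositional using (_⊎-⇔_)
open import Data.Empty using (⊥-elim)
open import Function using (_∘_; id; const)
open import Function.Bundles using (_⇔_; mk⇔; Equivalence)
open import Function.Construct.Composition using (_⇔-∘_)
open import Function.Construct.Symmetry using (⇔-sym)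
open import Function.Related.TypeIsomorphisms using (¬-cong-⇔)
open import Relation.Nullary using (¬_; Dec; yes; no; ¬?)
open import Relation.Nullary.Decidable using (T?; _×-dec_; _⊎-dec_; isYes)
open import Relation.Binary.PropositionalEquality using (_≡_; refl; sym; cong; subst)

open Equivalence using (to; from)

private variable
  Γ : List ℕ
  v : ℕ

T-injective : ∀ {a b} → T a ⇔ T b → a ≡ b
T-injective {false} {false} _ = refl
T-injective {false} {true}  a⇔b = ⊥-elim (from a⇔b _)
T-injective {true}  {false} a⇔b = ⊥-elim (to a⇔b _)
T-injective {true}  {true}  _ = refl

¬T⇔≡false : ∀ {b} → (¬ T b) ⇔ (b ≡ false)
¬T⇔≡false {false} = mk⇔ (const refl) (const λ ())
¬T⇔≡false {true}  = mk⇔ (λ ¬t → ⊥-elim (¬t _)) (λ ())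

⇒-elim : ∀ {a b} {P : Set a} {Q : Set b} → ¬ P ⊎ Q → P → Q
⇒-elim (inj₁ ¬p) p = ⊥-elim (¬p p)
⇒-elim (inj₂ q)  _ = q

⇒-intro : ∀ {a b} {P : Set a} {Q : Set b} → Dec P → (P → Q) → ¬ P ⊎ Q
⇒-intro (yes p) p→q = inj₂ (p→q p)
⇒-intro (no ¬p) _   = inj₁ ¬p

module _ (A : Structure) where

  AdjacentToAll : VSubset A → Fin (size A) → Set
  AdjacentToAll S x = ∀ y → T (S y) → T (E A x y) × T (E A y x)

  insert : Fin (size A) → VSubset A → VSubset A
  insert x S y = isYes (y ≟ᶠ x) ∨ S y

  module _ {x : Fin (size A)} {S : VSubset A} where

    insert-∋ : T (insert x S x)
    insert-∋ with x ≟ᶠ x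
    ... | yes _  = _
    ... | no x≢x = ⊥-elim (x≢x refl)

    insert-⊇ : ∀ y → T (S y) → T (insert x S y)
    insert-⊇ y y∈S with y ≟ᶠ x
    ... | yes _ = _
    ... | no _  = y∈S

    ∈-insert : ∀ {y} → T (insert x S y) → y ≡ x ⊎ T (S y)
    ∈-insert {y} with y ≟ᶠ x
    ... | yes y≡x = λ _ → inj₁ y≡x
    ... | no _    = inj₂

    insert-clique : IsClique A S → AdjacentToAll S x → IsClique A (insert x S)
    insert-clique cl adj a b a∈ b∈ a≢b with ∈-insert a∈ | ∈-insert b∈
    ... | inj₁ refl | inj₁ refl = ⊥-elim (a≢b refl)
    ... | inj₁ refl | inj₂ b∈S  = proj₁ (adj b b∈S)
    ... | inj₂ a∈S  | inj₁ refl = proj₂ (adj a a∈S)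
    ... | inj₂ a∈S  | inj₂ b∈S  = cl a b a∈S b∈S a≢b

  maximalClique⇔ : ∀ {S} →
    IsMaximalClique A S ⇔ (IsClique A S × ∀ x → AdjacentToAll S x → T (S x))
  maximalClique⇔ {S} = mk⇔ unextendable maximal
    where
    unextendable : IsMaximalClique A S → IsClique A S × ∀ x → AdjacentToAll S x → T (S x)
    unextendable (cl , max) =
      cl , λ x adj → max (insert x S) (insert-clique cl adj) insert-⊇ x (insert-∋ {x} {S})

    maximal : IsClique A S × (∀ x → AdjacentToAll S x → T (S x)) → IsMaximalClique A S
    maximal (cl , closed) = cl , extension⊆
      where
      extension⊆ : ∀ S′ → IsClique A S′ → (∀ x → T (S x) → T (S′ x)) →
                   ∀ x → T (S′ x) → T (S x)
      extension⊆ S′ cl′ S⊆S′ x x∈S′ with T? (S x)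
      ... | yes x∈S = x∈S
      ... | no  x∉S = closed x λ y y∈S →
        let x≢y = λ { refl → x∉S y∈S } in
        cl′ x y x∈S′ (S⊆S′ y y∈S) x≢y , cl′ y x (S⊆S′ y y∈S) x∈S′ (x≢y ∘ sym)

testBit? : ∀ i j → Dec (testBit i j)
testBit? i zero    = i % 2 ℕ.≟ 1
testBit? i (suc j) = testBit? (i / 2) j

sat? : (A : Structure) (σ : All (Rel (size A)) Γ) (ρ : Vec (Fin (size A)) v)
       (φ : Formula Γ v) → Dec (Sat A σ ρ φ)
sat? A σ ρ (edge s t)    = T? _
sat? A σ ρ (eq s t)      = _ ≟ᶠ _
sat? A σ ρ (leq s t)     = _ ℕ.≤? _
sat? A σ ρ (bit s t)     = testBit? (toℕ (evalT ρ s)) (toℕ (evalT ρ t))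
sat? A σ ρ (succ s t)    = _ ℕ.≟ _
sat? A σ ρ (plus s t u)  = _ ℕ.≟ _
sat? A σ ρ (times s t u) = _ ℕ.≟ _
sat? A σ ρ (rel x ts)    = T? _
sat? A σ ρ (¬′ φ)        = ¬? (sat? A σ ρ φ)
sat? A σ ρ (φ ∧′ ψ)      = sat? A σ ρ φ ×-dec sat? A σ ρ ψ
sat? A σ ρ (φ ∨′ ψ)      = sat? A σ ρ φ ⊎-dec sat? A σ ρ ψ
sat? A σ ρ (∀′ φ)        = all? λ x → sat? A σ (x ∷ ρ) φ
sat? A σ ρ (∃′ φ)        = any? λ x → sat? A σ (x ∷ ρ) φ

x₀ : Term (suc v)
x₀ = var fzero

x₁ : Term (suc (suc v))
x₁ = var (fsuc fzero)

⊥′ : Formula Γ v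
⊥′ = ¬′ eq c0 c0

_⇒′_ : Formula Γ v → Formula Γ v → Formula Γ v
φ ⇒′ ψ = (¬′ φ) ∨′ ψ

infixr 4 _⇒′_

member : 1 ∈ Γ → Term v → Formula Γ v
member S t = rel S (t ∷ [])

below : ℕ → Formula Γ (suc v)
below zero    = ⊥′
below (suc j) = eq x₀ c0 ∨′ ∃′ (succ x₀ x₁ ∧′ below j)

sizeBelow : ℕ → Formula Γ 0
sizeBelow zero    = ⊥′
sizeBelow (suc n) = ∃′ (eq x₀ cmax ∧′ below n)

simpleGraph : Formula Γ 0
simpleGraph = ∀′ (∀′ (edge x₁ x₀ ⇒′ edge x₀ x₁)) ∧′ ∀′ (¬′ edge x₀ x₀)

clique : 1 ∈ Γ → Formula Γ 0
clique S = ∀′ (∀′ (member S x₁ ⇒′ member S x₀ ⇒′ ¬′ eq x₁ x₀ ⇒′ edge x₁ x₀))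

adjacentToAll : 1 ∈ Γ → Formula Γ (suc v)
adjacentToAll S = ∀′ (member S x₀ ⇒′ edge x₁ x₀ ∧′ edge x₀ x₁)

maximalClique : 1 ∈ Γ → Formula Γ 0
maximalClique S = clique S ∧′ ∀′ (adjacentToAll S ⇒′ member S x₀)

monochromatic : 1 ∈ Γ → 1 ∈ Γ → Formula Γ 0
monochromatic C S = ∀′ (member S x₀ ⇒′ member C x₀) ∨′ ∀′ (member S x₀ ⇒′ ¬′ member C x₀)

module _ (A : Structure) (σ : All (Rel (size A)) Γ) where

  ⟦_⟧ : 1 ∈ Γ → VSubset A
  ⟦ S ⟧ x = All.lookup σ S (x ∷ [])

  below-sound : ∀ (ρ : Vec (Fin (size A)) v) j x → Sat A σ (x ∷ ρ) (below j) → toℕ x < j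
  below-sound ρ zero    x ¬x≡x = ⊥-elim (¬x≡x refl)
  below-sound ρ (suc j) x (inj₁ refl) = s≤s z≤n
  below-sound ρ (suc j) x (inj₂ (y , x≡1+y , y<j)) =
    subst (_< suc j) (sym x≡1+y) (s≤s (below-sound (x ∷ ρ) j y y<j))

  below-complete : ∀ (ρ : Vec (Fin (size A)) v) j x → toℕ x < j → Sat A σ (x ∷ ρ) (below j)
  below-complete ρ (suc j) fzero    _         = inj₁ refl
  below-complete ρ (suc j) (fsuc y) (s≤s y<j) =
    inj₂ (inject₁ y , cong suc (sym (toℕ-inject₁ y)) ,
          below-complete (fsuc y ∷ ρ) j (inject₁ y) (subst (_< j) (sym (toℕ-inject₁ y)) y<j))

  sat-sizeBelow : ∀ n → Sat A σ [] (sizeBelow n) ⇔ size A < n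
  sat-sizeBelow zero    = mk⇔ (λ ¬refl → ⊥-elim (¬refl refl)) λ ()
  sat-sizeBelow (suc n) = mk⇔ sound complete
    where
    sound : Sat A σ [] (sizeBelow (suc n)) → size A < suc n
    sound (_ , refl , max<n) = s≤s (subst (_< n) (toℕ-fromℕ (k A)) (below-sound [] n _ max<n))

    complete : size A < suc n → Sat A σ [] (sizeBelow (suc n))
    complete (s≤s k<n) =
      fromℕ (k A) , refl , below-complete [] n _ (subst (_< n) (sym (toℕ-fromℕ (k A))) k<n)

  sat-simpleGraph : Sat A σ [] simpleGraph ⇔ IsSimpleGraph A
  sat-simpleGraph = mk⇔
    (λ (sym′ , irr) → (λ x y → T-injective (mk⇔ (⇒-elim (sym′ x y)) (⇒-elim (sym′ y x))))
                     , (λ x → to ¬T⇔≡false (irr x)))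
    (λ (sym′ , irr) → (λ x y → ⇒-intro (T? (E A x y)) (subst T (sym′ x y)))
                     , (λ x → from ¬T⇔≡false (irr x)))

  sat-clique : ∀ S → Sat A σ [] (clique S) ⇔ IsClique A ⟦ S ⟧
  sat-clique S = mk⇔
    (λ cl x y x∈S y∈S x≢y → ⇒-elim (⇒-elim (⇒-elim (cl x y) x∈S) y∈S) x≢y)
    (λ cl x y → ⇒-intro (T? (⟦ S ⟧ x)) λ x∈S → ⇒-intro (T? (⟦ S ⟧ y)) λ y∈S →
                ⇒-intro (¬? (x ≟ᶠ y)) (cl x y x∈S y∈S))

  sat-adjacentToAll : ∀ S (ρ : Vec (Fin (size A)) v) x →
                      Sat A σ (x ∷ ρ) (adjacentToAll S) ⇔ AdjacentToAll A ⟦ S ⟧ x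
  sat-adjacentToAll S ρ x =
    mk⇔ (λ adj y → ⇒-elim (adj y)) (λ adj y → ⇒-intro (T? (⟦ S ⟧ y)) (adj y))

  sat-maximalClique : ∀ S → Sat A σ [] (maximalClique S) ⇔ IsMaximalClique A ⟦ S ⟧
  sat-maximalClique S = ⇔-sym (maximalClique⇔ A) ⇔-∘ (sat-clique S ×-⇔ mk⇔
    (λ closed x → ⇒-elim (closed x) ∘ from (sat-adjacentToAll S [] x))
    (λ closed x → ⇒-intro (sat? A σ (x ∷ []) (adjacentToAll S))
                            (closed x ∘ to (sat-adjacentToAll S [] x))))

  sat-monochromatic : ∀ C S → Sat A σ [] (monochromatic C S) ⇔ Monochromatic A ⟦ C ⟧ ⟦ S ⟧
  sat-monochromatic C S = mk⇔ sound complete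
    where
    sound : Sat A σ [] (monochromatic C S) → Monochromatic A ⟦ C ⟧ ⟦ S ⟧
    sound (inj₁ h) = true  , λ x x∈S → to T-≡ (⇒-elim (h x) x∈S)
    sound (inj₂ h) = false , λ x x∈S → to ¬T⇔≡false (⇒-elim (h x) x∈S)

    complete : Monochromatic A ⟦ C ⟧ ⟦ S ⟧ → Sat A σ [] (monochromatic C S)
    complete (true  , h) = inj₁ λ x → ⇒-intro (T? (⟦ S ⟧ x)) (from T-≡ ∘ h x)
    complete (false , h) = inj₂ λ x → ⇒-intro (T? (⟦ S ⟧ x)) (from ¬T⇔≡false ∘ h x)

unary : ∀ {m} → (Fin m → Bool) → Rel m 1
unary P (x ∷ []) = P x

ofUnary : ∀ {m} → Rel m 1 → Fin m → Bool
ofUnary r x = r (x ∷ [])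

colour vertexSet : 1 ∈ 1 ∷ 1 ∷ []
colour    = here refl
vertexSet = there (here refl)

twoColourable : ℕ → Σ₂Sentence
twoColourable n = mkΣ₂ (1 ∷ []) (1 ∷ [])
  (sizeBelow n ∨′ (simpleGraph ∧′ (¬′ (maximalClique vertexSet ∧′ monochromatic colour vertexSet))))

module _ (n : ℕ) (A : Structure) where

  sat-twoColourable : ∀ (c s : Rel (size A) 1) →
    Sat A (c ∷ s ∷ []) [] (Σ₂Sentence.body (twoColourable n)) ⇔
    (size A < n ⊎ IsSimpleGraph A ×
                  ¬ (IsMaximalClique A (ofUnary s) × Monochromatic A (ofUnary c) (ofUnary s)))
  sat-twoColourable c s =
    sat-sizeBelow A σ n ⊎-⇔ sat-simpleGraph A σ ×-⇔
      ¬-cong-⇔ (sat-maximalClique A σ vertexSet ×-⇔ sat-monochromatic A σ colour vertexSet)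
    where σ = c ∷ s ∷ []

  models-twoColourable : Models A (twoColourable n) ⇔ In2CCn n A
  models-twoColourable = mk⇔ sound complete
    where
    sound : Models A (twoColourable n) → In2CCn n A
    sound (c ∷ [] , holds) with size A ℕ.<? n
    ... | yes small = inj₂ small
    ... | no  large =
      inj₁ (proj₁ (graphCase (const false)) , ofUnary c ,
            λ S maxS monoS → proj₂ (graphCase S) (maxS , monoS))
      where
      graphCase : ∀ S → IsSimpleGraph A ×
                        ¬ (IsMaximalClique A S × Monochromatic A (ofUnary c) S)
      graphCase S =
        [ ⊥-elim ∘ large , id ] (to (sat-twoColourable c (unary S)) (holds (unary S ∷ [])))

    complete : In2CCn n A → Models A (twoColourable n)
    complete (inj₂ small) =
      unary (const false) ∷ [] , λ { (s ∷ []) → from (sat-twoColourable _ s) (inj₁ small) }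
    complete (inj₁ (simple , c , proper)) =
      unary c ∷ [] , λ { (s ∷ []) →
        from (sat-twoColourable _ s) (inj₂ (simple , λ (maxS , monoS) → proper _ maxS monoS)) }

lemma3 : (n : ℕ) → 2 ≤ n → InΣ₂p (In2CCn n)
lemma3 n _ = twoColourable n , models-twoColourable n
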